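{- Let $n,w$ be integers with $2\le w\le n$ and $k$ an integer with $-n/(w-1)\le k\le n$. Let $R$ be a semistandard Young tableau of rectangular shape with $w$ columns and $n$ rows whose content consists of $w-1$ copies of each of $1,\ldots,n-k$ and one copy of each of $n-k+1,\ldots,2n+k(w-2)$. Let $Q'$ be obtained from the cells of $R$ with entries in $\{n-k+1,\ldots,2n+k(w-2)\}$ by rotating them by $180^\circ$ and replacing each entry $x$ by $2n+k(w-2)-x+1$; let $\lambda$ be its shape. Let $P''=\overline{R-Q'}^{w,n-k}$. If $k>0$ set $(P',Q)=(P'',Q')$, and otherwise set $(P',Q)=(Q',P'')$; then add $|kw|$ to every entry of $P'$. Let $M$ be any standard Young tableau of rectangular shape with $w$ columns and $|k|$ rows with entries $[|k|w]$. Then placing $M$ on top of $P'$ with the first columns of $M$ and $P'$ aligned produces a standard Young tableau $P$ of the same shape as $Q$.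
   Context: Semistandard tableaux: rows weakly, columns strictly increasing; standard: distinct entries with rows and columns strictly increasing. Columns are indexed left to right; a diagram $\lambda$ is described by column lengths $\lambda_i$. For $R$ of the $w\times n$ rectangular shape and $Q'$ of shape $\lambda$ (at most $w$ columns), $R-Q'$ is the tableau whose $i$-th column consists of the $n-\lambda_{w-i+1}$ smallest entries of the $i$-th column of $R$. For a tableau $A$ with columns $A_1,\ldots,A_w$ (possibly empty) and entries in $[N]$, the tableau complement $\overline{A}^{w,N}$ has $i$-th column equal to $[N]\setminus A_{w-i+1}$ in increasing order, $1\le i\le w$. -}

module Defs where

open import Data.Nat using (ℕ; zero; suc; _+_; _*_; _∸_; _≤_; _<_; _<?_; _≟_)
open import Data.Integer as ℤ using (ℤ; +_; -[1+_]; ∣_∣)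
open import Data.Bool using (Bool; true; false; if_then_else_)
open import Data.Product using (Σ; _×_)
open import Data.Fin using (Fin; inject≤)
open import Data.List using (List; []; _∷_; map; length; filter; reverse; take; zipWith; upTo; concat; concatMap; replicate; lookup; _++_)
open import Data.List.Relation.Unary.All using (All)
open import Data.List.Relation.Unary.Linked using (Linked)
open import Data.List.Relation.Unary.Unique.Propositional using (Unique)
open import Data.List.Membership.DecPropositional _≟_ using (_∈?_)
open import Relation.Nullary using (¬?)

-- A tableau is the list of its columns, left to right; each column is read
-- top to bottom.  Columns may be empty.
Tab : Set
Tab = List (List ℕ)

shape : Tab → List ℕ
shape = map length

-- d is the column right of c: d is not longer than c and the relation
-- _~_ holds between horizontally adjacent cells in every row of d.
AdjRows : (ℕ → ℕ → Set) → List ℕ → List ℕ → Set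
AdjRows _~_ c d =
  Σ (length d ≤ length c) λ le → (r : Fin (length d)) → lookup c (inject≤ r le) ~ lookup d r

Semistandard : Tab → Set
Semistandard T = All (Linked _<_) T × Linked (AdjRows _≤_) T

Standard : Tab → Set
Standard T = All (Linked _<_) T × Linked (AdjRows _<_) T × Unique (concat T)

-- the list a, a+1, ..., b   (empty if b < a)
rng : ℕ → ℕ → List ℕ
rng a b = map (λ i → a + i) (upTo (suc b ∸ a))

-- 0-indexed column access, empty column by default
colAt : Tab → ℕ → List ℕ
colAt [] _ = []
colAt (c ∷ _) zero = c
colAt (_ ∷ T) (suc i) = colAt T i

-- tableau complement  \overline{A}^{w,N}: (0-indexed) column i is
-- [N] \ A_{w-1-i} in increasing order, for i < w.
tabComplement : ℕ → ℕ → Tab → Tab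
tabComplement w N A =
  map (λ i → filter (λ x → ¬? (x ∈? colAt A (w ∸ suc i))) (rng 1 N)) (upTo w)

-- R - Q': (0-indexed) column i consists of the n - λ_{w-1-i} smallest
-- entries of column i of R (w = number of columns of R, n = its column
-- length; columns are increasing so the smallest entries form a prefix).
tabMinus : Tab → Tab → Tab
tabMinus R Q =
  zipWith (λ i c → take (length c ∸ length (colAt Q (length R ∸ suc i))) c)
          (upTo (length R)) R

-- cells of R with entries > m, rotated by 180 degrees inside the
-- rectangle, with each entry x replaced by N - x + 1.
rotatePart : ℕ → ℕ → Tab → Tab
rotatePart m N R =
  reverse (map (λ c → reverse (map (λ x → suc N ∸ x) (filter (λ x → m <? x) c))) R)

addAll : ℕ → Tab → Tab
addAll a = map (map (_+ a))

stackOn : Tab → Tab → Tab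
stackOn M P = zipWith _++_ M P

isPos : ℤ → Bool
isPos (+ suc _) = true
isPos _ = false

mOf : ℕ → ℤ → ℕ
mOf n k = ∣ + n ℤ.- k ∣

NOf : ℕ → ℕ → ℤ → ℕ
NOf n w k = ∣ + (2 * n) ℤ.+ k ℤ.* + (w ∸ 2) ∣

contentR : ℕ → ℕ → ℤ → List ℕ
contentR n w k =
  concatMap (replicate (w ∸ 1)) (rng 1 (mOf n k)) ++ rng (suc (mOf n k)) (NOf n w k)

Q'Of : ℕ → ℕ → ℤ → Tab → Tab
Q'Of n w k R = rotatePart (mOf n k) (NOf n w k) R

P''Of : ℕ → ℕ → ℤ → Tab → Tab
P''Of n w k R = tabComplement w (mOf n k) (tabMinus R (Q'Of n w k R))

QOf : ℕ → ℕ → ℤ → Tab → Tab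
QOf n w k R = if isPos k then Q'Of n w k R else P''Of n w k R

P'Of : ℕ → ℕ → ℤ → Tab → Tab
P'Of n w k R = addAll (∣ k ∣ * w) (if isPos k then P''Of n w k R else Q'Of n w k R)

POf : ℕ → ℕ → ℤ → Tab → Tab → Tab
POf n w k R M = stackOn M (P'Of n w k R)

-- List the columns of R from right to left (T = reverse R), and call
-- an entry small if it is ≤ m = n-k and large otherwise.  Column i of P'' is
-- the complement in [m] of the small part of the i-th column of T; column i
-- of Q' is its large part turned upside down with x replaced by N+1-x.
-- Both are prestandard: columns increase strictly, rows weakly, entries are
-- distinct and positive.  For the rows, small parts of adjacent columns are
-- rowwise ordered and complementation reverses this order (compare the
-- numbers of entries ≤ y), while large parts are bottom-aligned in the
-- rectangle and rotation makes them top-aligned.  Distinctness uses the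
-- content: a value ≤ m occurs in w-1 of the w columns of R, so it is missing
-- from at most one; a value > m occurs only once.  A standard rectangle M with
-- entries in [|k|w], stacked on a prestandard tableau shifted by |k|w, is
-- standard.  Finally a column with s small entries yields columns of lengths
-- m-s and n-s in P'' and Q', and m = n-k gives the shapes.
module Submission where

open import Defs
open import Data.Nat using (ℕ; zero; suc; _+_; _*_; _∸_; _≤_; _<_; _>_; z≤n; s≤s; _≟_; _≤?_; _<?_)
import Data.Nat.Properties as ℕP
open import Data.Integer as ℤ using (ℤ; +_; -[1+_]; ∣_∣)
import Data.Integer.Properties as ℤP
open import Data.Product using (_×_; _,_; proj₁; proj₂)
open import Data.Sum using (inj₁; inj₂)
import Data.Fin as Fin
import Data.List
open import Data.List using (List; []; _∷_; [_]; _++_; length; concat; map; filter; reverse; take; zipWith; upTo; applyUpTo; replicate)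
import Data.List.Properties as LP
open import Data.List.Relation.Unary.All as All using (All; []; _∷_)
import Data.List.Relation.Unary.All.Properties as AllP
open import Data.List.Relation.Unary.AllPairs using ([]; _∷_)
open import Data.List.Relation.Unary.Any using (here; there)
open import Data.List.Relation.Unary.Linked as Linked using (Linked; []; [-]; _∷_)
import Data.List.Relation.Unary.Linked.Properties as LinkedP
open import Data.List.Relation.Unary.Unique.Propositional using (Unique)
import Data.List.Relation.Unary.Unique.Propositional.Properties as UniqueP
open import Data.List.Relation.Binary.Pointwise as Pointwise using (Pointwise; []; _∷_)
open import Data.List.Membership.Propositional using (_∈_; _∉_)
open import Data.List.Membership.DecPropositional _≟_ using (_∈?_)
import Data.List.Membership.Propositional.Properties as ∈P
open import Data.List.Relation.Binary.Permutation.Propositional as Perm using (_↭_; ↭⇒↭ₛ)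
import Data.List.Relation.Binary.Permutation.Propositional.Properties as PermP
import Data.List.Relation.Binary.Permutation.Setoid.Properties as PermS
open import Data.Empty using (⊥; ⊥-elim)
open import Function using (_∘_; flip; id)
open import Relation.Nullary using (yes; no; ¬_; ¬?)
open import Relation.Unary using (Decidable)
open import Relation.Binary using (Transitive)
open import Algebra.Properties.CommutativeSemigroup ℕP.+-commutativeSemigroup using (interchange; x∙yz≈y∙xz)
open import Relation.Binary.PropositionalEquality using (_≡_; _≢_; refl; sym; trans; cong; cong₂; subst; subst₂; setoid; module ≡-Reasoning)

linked-head : ∀ {A : Set} {R : A → A → Set} → Transitive R → ∀ {x xs} → Linked R (x ∷ xs) → All (R x) xs
linked-head R-trans [-] = []
linked-head R-trans (r ∷ l) = LinkedP.Linked⇒All R-trans r l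

linked-reverse : ∀ {A : Set} {R : A → A → Set} {xs} → Linked R xs → Linked (flip R) (reverse xs)
linked-reverse {xs = []} _ = []
linked-reverse {R = R} {xs = _ ∷ _} l = go [-] l
  where
  -- acc is the reversed part already traversed, its head x shared with the rest
  go : ∀ {x xs acc} → Linked (flip R) (x ∷ acc) → Linked R (x ∷ xs) → Linked (flip R) (Data.List.reverseAcc (x ∷ acc) xs)
  go acc [-] = acc
  go acc (r ∷ l) = go (r ∷ acc) l

sorted-ext : ∀ {xs ys} → Linked _<_ xs → Linked _<_ ys →
  (∀ {z} → z ∈ xs → z ∈ ys) → (∀ {z} → z ∈ ys → z ∈ xs) → xs ≡ ys
sorted-ext {[]} {[]} _ _ _ _ = refl
sorted-ext {[]} {y ∷ ys} _ _ _ ys⊆ with ys⊆ (here refl)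
... | ()
sorted-ext {x ∷ xs} {[]} _ _ xs⊆ _ with xs⊆ (here refl)
... | ()
sorted-ext {x ∷ xs} {y ∷ ys} xs↑ ys↑ xs⊆ ys⊆ with xs⊆ (here refl) | ys⊆ (here refl)
... | here refl | _ = cong (x ∷_) (sorted-ext (Linked.tail xs↑) (Linked.tail ys↑)
        (λ z∈ → off-head xs↑ z∈ (xs⊆ (there z∈))) (λ z∈ → off-head ys↑ z∈ (ys⊆ (there z∈))))
  where
  off-head : ∀ {u us vs z} → Linked _<_ (u ∷ us) → z ∈ us → z ∈ u ∷ vs → z ∈ vs
  off-head u↑ z∈us (here refl) = ⊥-elim (ℕP.<-irrefl refl (All.lookup (linked-head ℕP.<-trans u↑) z∈us))
  off-head u↑ z∈us (there z∈vs) = z∈vs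
... | there x∈ys | here refl = ⊥-elim (ℕP.<-irrefl refl (All.lookup (linked-head ℕP.<-trans ys↑) x∈ys))
... | there x∈ys | there y∈xs =
  ⊥-elim (ℕP.<-asym (All.lookup (linked-head ℕP.<-trans ys↑) x∈ys) (All.lookup (linked-head ℕP.<-trans xs↑) y∈xs))

linked-map : ∀ {A B : Set} {R : A → A → Set} {R' : B → B → Set} {P : A → Set} (h : A → B) {xs} →
  (∀ {x y} → P x → P y → R x y → R' (h x) (h y)) → All P xs → Linked R xs → Linked R' (map h xs)
linked-map h mono _ [] = []
linked-map h mono _ [-] = [-]
linked-map h mono (px ∷ ps@(py ∷ _)) (r ∷ l) = mono px py r ∷ linked-map h mono ps l

filter-reverse : ∀ {P : ℕ → Set} (P? : Decidable P) xs → filter P? (reverse xs) ≡ reverse (filter P? xs)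
filter-reverse P? [] = refl
filter-reverse P? (x ∷ xs) = begin
  filter P? (reverse (x ∷ xs))               ≡⟨ cong (filter P?) (LP.unfold-reverse x xs) ⟩
  filter P? (reverse xs ++ [ x ])            ≡⟨ LP.filter-++ P? (reverse xs) [ x ] ⟩
  filter P? (reverse xs) ++ filter P? [ x ]  ≡⟨ cong (_++ filter P? [ x ]) (filter-reverse P? xs) ⟩
  reverse (filter P? xs) ++ filter P? [ x ]  ≡⟨ last-step ⟩
  reverse (filter P? (x ∷ xs))               ∎
  where
  open ≡-Reasoning
  last-step : reverse (filter P? xs) ++ filter P? [ x ] ≡ reverse (filter P? (x ∷ xs))
  last-step with P? x
  ... | yes _ = sym (LP.unfold-reverse x (filter P? xs))
  ... | no _ = LP.++-identityʳ _

concat-reverse : ∀ (R : Tab) → concat (reverse R) ↭ concat R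
concat-reverse [] = Perm.refl
concat-reverse (c ∷ R) = begin
  concat (reverse (c ∷ R))        ≡⟨ cong concat (LP.unfold-reverse c R) ⟩
  concat (reverse R ++ [ c ])     ≡⟨ sym (LP.concat-++ (reverse R) [ c ]) ⟩
  concat (reverse R) ++ c ++ []   ≡⟨ cong (concat (reverse R) ++_) (LP.++-identityʳ c) ⟩
  concat (reverse R) ++ c         ↭⟨ PermP.++⁺ʳ c (concat-reverse R) ⟩
  concat R ++ c                   ↭⟨ PermP.++-comm (concat R) c ⟩
  c ++ concat R                   ∎
  where open Perm.PermutationReasoning

module _ {P : ℕ → Set} (P? : Decidable P) where

  length-filter-split : ∀ xs → length (filter P? xs) + length (filter (¬? ∘ P?) xs) ≡ length xs
  length-filter-split [] = refl
  length-filter-split (x ∷ xs) with P? x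
  ... | yes _ = cong suc (length-filter-split xs)
  ... | no _ = trans (ℕP.+-suc _ _) (cong suc (length-filter-split xs))

  count-filter-split : ∀ {Q : ℕ → Set} (Q? : Decidable Q) xs →
    length (filter Q? (filter P? xs)) + length (filter Q? (filter (¬? ∘ P?) xs)) ≡ length (filter Q? xs)
  count-filter-split Q? [] = refl
  count-filter-split Q? (x ∷ xs) with P? x
  ... | yes _ with Q? x
  ...   | yes _ = cong suc (count-filter-split Q? xs)
  ...   | no _ = count-filter-split Q? xs
  count-filter-split Q? (x ∷ xs) | no _ with Q? x
  ...   | yes _ = trans (ℕP.+-suc _ _) (cong suc (count-filter-split Q? xs))
  ...   | no _ = count-filter-split Q? xs

linked-++-separated : ∀ {B xs ys} → Linked _<_ xs → Linked _<_ ys → All (_≤ B) xs → All (B <_) ys → Linked _<_ (xs ++ ys)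
linked-++-separated [] ys↑ _ _ = ys↑
linked-++-separated {ys = []} [-] _ _ _ = [-]
linked-++-separated {ys = _ ∷ _} [-] ys↑ (x≤B ∷ []) (B<y ∷ _) = ℕP.≤-<-trans x≤B B<y ∷ ys↑
linked-++-separated (r ∷ xs↑) ys↑ (_ ∷ xs≤B) B<ys = r ∷ linked-++-separated xs↑ ys↑ xs≤B B<ys

mult : ℕ → List ℕ → ℕ
mult z xs = length (filter (z ≟_) xs)

mult-++ : ∀ z xs ys → mult z (xs ++ ys) ≡ mult z xs + mult z ys
mult-++ z xs ys = trans (cong length (LP.filter-++ (z ≟_) xs ys)) (LP.length-++ (filter (z ≟_) xs))

mult-↭ : ∀ z {xs ys} → xs ↭ ys → mult z xs ≡ mult z ys
mult-↭ z p = PermP.↭-length (PermP.filter-↭ (z ≟_) p)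

mult-∈ : ∀ {z xs} → z ∈ xs → 1 ≤ mult z xs
mult-∈ = LP.filter-some (_ ≟_)

mult-∉ : ∀ {z} xs → z ∉ xs → mult z xs ≡ 0
mult-∉ xs z∉ = cong length (LP.filter-none (_ ≟_) (AllP.¬Any⇒All¬ xs z∉))

mult-All : ∀ {P : ℕ → Set} {z} xs → All P xs → ¬ P z → mult z xs ≡ 0
mult-All xs ps ¬pz = mult-∉ xs (λ z∈ → ¬pz (All.lookup ps z∈))

mult-hit : ∀ {z x} xs → z ≡ x → mult z (x ∷ xs) ≡ suc (mult z xs)
mult-hit xs z≡x = cong length (LP.filter-accept (_ ≟_) {xs = xs} z≡x)

mult-miss : ∀ {z x} xs → z ≢ x → mult z (x ∷ xs) ≡ mult z xs
mult-miss xs z≢x = cong length (LP.filter-reject (_ ≟_) {xs = xs} z≢x)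

mult-∷ : ∀ z x xs → mult z xs ≤ mult z (x ∷ xs)
mult-∷ z x xs with z ≟ x
... | yes z≡x = ℕP.≤-trans (ℕP.n≤1+n _) (ℕP.≤-reflexive (sym (mult-hit xs z≡x)))
... | no z≢x = ℕP.≤-reflexive (sym (mult-miss xs z≢x))

mult-sorted : ∀ z {xs} → Linked _<_ xs → mult z xs ≤ 1
mult-sorted z {[]} _ = z≤n
mult-sorted z {x ∷ xs} xs↑ with z ≟ x
... | yes z≡x = ℕP.≤-reflexive (trans (mult-hit xs z≡x)
        (cong suc (mult-All xs (linked-head ℕP.<-trans xs↑) (ℕP.<-irrefl (sym z≡x)))))
... | no z≢x = ℕP.≤-trans (ℕP.≤-reflexive (mult-miss xs z≢x)) (mult-sorted z (Linked.tail xs↑))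

mult-filter : ∀ {P : ℕ → Set} (P? : Decidable P) z xs → mult z (filter P? xs) ≤ mult z xs
mult-filter P? z [] = z≤n
mult-filter P? z (x ∷ xs) with P? x
... | yes _ = cons-mono (mult-filter P? z xs)
  where
  cons-mono : ∀ {ys} → mult z ys ≤ mult z xs → mult z (x ∷ ys) ≤ mult z (x ∷ xs)
  cons-mono {ys} le with z ≟ x
  ... | yes z≡x = subst₂ _≤_ (sym (mult-hit ys z≡x)) (sym (mult-hit xs z≡x)) (s≤s le)
  ... | no z≢x = subst₂ _≤_ (sym (mult-miss ys z≢x)) (sym (mult-miss xs z≢x)) le
... | no _ = ℕP.≤-trans (mult-filter P? z xs) (mult-∷ z x xs)

mult-map : ∀ (h : ℕ → ℕ) {z z'} xs → (∀ {y} → y ∈ xs → h y ≡ z → y ≡ z') → mult z (map h xs) ≤ mult z' xs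
mult-map h [] _ = z≤n
mult-map h {z} {z'} (x ∷ xs) preimage with z ≟ h x
... | yes z≡hx = subst₂ _≤_ (sym (mult-hit (map h xs) z≡hx)) (sym (mult-hit xs (sym (preimage (here refl) (sym z≡hx)))))
        (s≤s (mult-map h xs (preimage ∘ there)))
... | no z≢hx = ℕP.≤-trans (ℕP.≤-reflexive (mult-miss (map h xs) z≢hx))
        (ℕP.≤-trans (mult-map h xs (preimage ∘ there)) (mult-∷ z' x xs))

mult-concat : ∀ {A : Set} (f g : A → List ℕ) z z' xss → All (λ c → mult z (f c) ≤ mult z' (g c)) xss →
  mult z (concat (map f xss)) ≤ mult z' (concat (map g xss))
mult-concat f g z z' [] _ = z≤n
mult-concat f g z z' (c ∷ xss) (le ∷ les) = subst₂ _≤_ (sym (mult-++ z (f c) _)) (sym (mult-++ z' (g c) _))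
  (ℕP.+-mono-≤ le (mult-concat f g z z' xss les))

mult≤1⇒unique : ∀ xs → (∀ z → mult z xs ≤ 1) → Unique xs
mult≤1⇒unique [] _ = []
mult≤1⇒unique (x ∷ xs) once = All.tabulate x∉xs ∷ mult≤1⇒unique xs (λ z → ℕP.≤-trans (mult-∷ z x xs) (once z))
  where
  x∉xs : ∀ {y} → y ∈ xs → x ≢ y
  x∉xs y∈ refl = ℕP.<-irrefl refl (ℕP.≤-trans (s≤s (mult-∈ y∈)) (subst (_≤ 1) (mult-hit xs refl) (once x)))

<∸⇒+< : ∀ {i K a} → i < K ∸ a → a + i < K
<∸⇒+< {a = zero} i<K = i<K
<∸⇒+< {K = suc K} {a = suc a} i<K∸a = s≤s (<∸⇒+< {K = K} {a = a} i<K∸a)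

rng-bounds : ∀ a b → All (λ x → a ≤ x × x ≤ b) (rng a b)
rng-bounds a b = AllP.map⁺ (All.tabulate (λ {i} i∈ →
  ℕP.m≤m+n a i , ℕP.≤-pred (<∸⇒+< {i} {suc b} {a} (∈P.∈-upTo⁻ i∈))))

rng-∈ : ∀ {a b x} → a ≤ x → x ≤ b → x ∈ rng a b
rng-∈ {a} {b} a≤x x≤b = subst (_∈ rng a b) (ℕP.m+[n∸m]≡n a≤x)
  (∈P.∈-map⁺ (_+_ a) (∈P.∈-upTo⁺ (subst (_≤ suc b ∸ a) (ℕP.+-∸-assoc 1 a≤x) (ℕP.∸-monoˡ-≤ a (s≤s x≤b)))))

rng-sorted : ∀ a b → Linked _<_ (rng a b)
rng-sorted a b = subst (Linked _<_) (sym (LP.map-upTo (_+_ a) (suc b ∸ a)))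
  (LinkedP.applyUpTo⁺₁ (_+_ a) (suc b ∸ a) (λ _ → ℕP.+-monoʳ-< a ℕP.≤-refl))

length-rng : ∀ m → length (rng 1 m) ≡ m
length-rng m = trans (LP.length-map (_+_ 1) (upTo m)) (LP.length-upTo m)

-- RowWise _~_ c d: column d can stand directly right of column c, top
-- rows aligned: d is not longer than c and each row of d relates to c.
-- This is the inductive form of Defs.AdjRows; the two are interconvertible.
data RowWise (_~_ : ℕ → ℕ → Set) : List ℕ → List ℕ → Set where
  [] : ∀ {c} → RowWise _~_ c []
  _∷_ : ∀ {x y c d} → x ~ y → RowWise _~_ c d → RowWise _~_ (x ∷ c) (y ∷ d)

adj⇒rowWise : ∀ {_~_} c d → AdjRows _~_ c d → RowWise _~_ c d
adj⇒rowWise c [] _ = []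
adj⇒rowWise [] (y ∷ d) (() , _)
adj⇒rowWise (x ∷ c) (y ∷ d) (s≤s len , rows) = rows Fin.zero ∷ adj⇒rowWise c d (len , rows ∘ Fin.suc)

rowWise⇒adj : ∀ {_~_} c d → RowWise _~_ c d → AdjRows _~_ c d
rowWise⇒adj c [] [] = z≤n , λ ()
rowWise⇒adj (x ∷ c) (y ∷ d) (x~y ∷ rest) = s≤s (proj₁ (rowWise⇒adj c d rest)) , rows
  where
  rows : ∀ i → _
  rows Fin.zero = x~y
  rows (Fin.suc i) = proj₂ (rowWise⇒adj c d rest) i

rowWise-map : ∀ {_~_ _≈_ c d} (h : ℕ → ℕ) → (∀ {u v} → u ~ v → h u ≈ h v) → RowWise _~_ c d → RowWise _≈_ (map h c) (map h d)
rowWise-map h mono [] = []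
rowWise-map h mono (r ∷ rs) = mono r ∷ rowWise-map h mono rs

rowWise-strict : ∀ {c d} → RowWise _≤_ c d → (∀ {z} → z ∈ c → z ∈ d → ⊥) → RowWise _<_ c d
rowWise-strict [] _ = []
rowWise-strict (x≤y ∷ rs) disjoint with ℕP.m≤n⇒m<n∨m≡n x≤y
... | inj₁ x<y = x<y ∷ rowWise-strict rs (λ z∈c z∈d → disjoint (there z∈c) (there z∈d))
... | inj₂ refl = ⊥-elim (disjoint (here refl) (here refl))

rowWise-++ : ∀ {_~_ c d c' d'} → RowWise _~_ c d → length c ≡ length d → RowWise _~_ c' d' → RowWise _~_ (c ++ c') (d ++ d')
rowWise-++ {c = []} [] _ rs' = rs'
rowWise-++ (r ∷ rs) len rs' = r ∷ rowWise-++ rs (ℕP.suc-injective len) rs'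

rowWise⇒pointwise : ∀ {_~_ c d} → RowWise _~_ c d → length c ≡ length d → Pointwise _~_ c d
rowWise⇒pointwise {c = []} [] _ = []
rowWise⇒pointwise (r ∷ rs) len = r ∷ rowWise⇒pointwise rs (ℕP.suc-injective len)

atMost : ℕ → List ℕ → ℕ
atMost y xs = length (filter (_≤? y) xs)

atMost-hit : ∀ {y x} xs → x ≤ y → atMost y (x ∷ xs) ≡ suc (atMost y xs)
atMost-hit xs x≤y = cong length (LP.filter-accept (_≤? _) {xs = xs} x≤y)

atMost-none : ∀ {y} xs → All (y <_) xs → atMost y xs ≡ 0
atMost-none xs y<xs = cong length (LP.filter-none (_≤? _) (All.map ℕP.<⇒≱ y<xs))

rowWise⇒atMost : ∀ {c d} → RowWise _≤_ c d → Linked _<_ d → ∀ y → atMost y d ≤ atMost y c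
rowWise⇒atMost [] _ y = z≤n
rowWise⇒atMost {x ∷ c} {x' ∷ d} (x≤x' ∷ rs) d↑ y with x' ≤? y
... | yes x'≤y = subst₂ _≤_ (sym (atMost-hit d x'≤y)) (sym (atMost-hit c (ℕP.≤-trans x≤x' x'≤y)))
        (s≤s (rowWise⇒atMost rs (Linked.tail d↑) y))
... | no x'≰y = ℕP.≤-trans (ℕP.≤-reflexive (atMost-none (x' ∷ d)
        (ℕP.≰⇒> x'≰y ∷ All.map (ℕP.<-trans (ℕP.≰⇒> x'≰y)) (linked-head ℕP.<-trans d↑)))) z≤n

atMost⇒rowWise : ∀ {c d} → Linked _<_ c → Linked _<_ d → (∀ y → atMost y d ≤ atMost y c) → RowWise _≤_ c d
atMost⇒rowWise {c} {[]} _ _ _ = []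
atMost⇒rowWise {[]} {x' ∷ d} _ _ fewer with subst (_≤ 0) (atMost-hit {x'} d ℕP.≤-refl) (fewer x')
... | ()
atMost⇒rowWise {x ∷ c} {x' ∷ d} c↑ d↑ fewer = x≤x' ∷ atMost⇒rowWise (Linked.tail c↑) (Linked.tail d↑) fewer'
  where
  -- if x > x', then c has no entry ≤ x' while d has one
  x≤x' : x ≤ x'
  x≤x' with x ≤? x'
  ... | yes le = le
  ... | no x≰x' = ⊥-elim (ℕP.<-irrefl refl (ℕP.≤-trans
        (subst (1 ≤_) (sym (atMost-hit {x'} d ℕP.≤-refl)) (s≤s z≤n))
        (ℕP.≤-trans (fewer x') (ℕP.≤-reflexive (atMost-none (x ∷ c)
           (ℕP.≰⇒> x≰x' ∷ All.map (ℕP.<-trans (ℕP.≰⇒> x≰x')) (linked-head ℕP.<-trans c↑)))))))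
  fewer' : ∀ y → atMost y d ≤ atMost y c
  fewer' y with x' ≤? y
  ... | yes x'≤y = ℕP.≤-pred (subst₂ _≤_ (atMost-hit d x'≤y) (atMost-hit c (ℕP.≤-trans x≤x' x'≤y)) (fewer y))
  ... | no x'≰y = ℕP.≤-trans (ℕP.≤-reflexive (atMost-none d
        (All.map (ℕP.<-trans (ℕP.≰⇒> x'≰y)) (linked-head ℕP.<-trans d↑)))) z≤n

-- Both P'' and Q' have this property; distinctness then makes rows strict.
record Prestandard (X : Tab) : Set where
  field
    columns : All (Linked _<_) X
    rows : Linked (RowWise _≤_) X
    distinct : Unique (concat X)
    positive : All (All (1 ≤_)) X

unique-↭ : ∀ {xs ys} → xs ↭ ys → Unique xs → Unique ys
unique-↭ p = PermS.Unique-resp-↭ (setoid ℕ) (↭⇒↭ₛ p)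

unique-++ʳ : ∀ (xs : List ℕ) {ys} → Unique (xs ++ ys) → Unique ys
unique-++ʳ [] u = u
unique-++ʳ (_ ∷ xs) (_ ∷ u) = unique-++ʳ xs u

unique-disjoint : ∀ (xs : List ℕ) {ys z} → Unique (xs ++ ys) → z ∈ xs → z ∈ ys → ⊥
unique-disjoint (x ∷ xs) (x∉ ∷ _) (here refl) z∈ys = All.lookup x∉ (∈P.∈-++⁺ʳ xs z∈ys) refl
unique-disjoint (x ∷ xs) (_ ∷ u) (there z∈xs) z∈ys = unique-disjoint xs u z∈xs z∈ys

rows-strict : ∀ X → Linked (RowWise _≤_) X → Unique (concat X) → Linked (RowWise _<_) X
rows-strict [] _ _ = []
rows-strict (_ ∷ []) _ _ = [-]
rows-strict (c ∷ d ∷ X) (c≤d ∷ rows) u =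
  rowWise-strict c≤d (λ z∈c z∈d → unique-disjoint c u z∈c (∈P.∈-++⁺ˡ z∈d))
  ∷ rows-strict (d ∷ X) rows (unique-++ʳ c u)

concat-stack-↭ : ∀ (M Y : Tab) → length M ≡ length Y → concat (zipWith _++_ M Y) ↭ concat M ++ concat Y
concat-stack-↭ [] [] _ = Perm.refl
concat-stack-↭ (c ∷ M) (d ∷ Y) len = begin
  (c ++ d) ++ concat (zipWith _++_ M Y)  ↭⟨ PermP.++⁺ˡ (c ++ d) (concat-stack-↭ M Y (ℕP.suc-injective len)) ⟩
  (c ++ d) ++ (concat M ++ concat Y)     ≡⟨ LP.++-assoc c d _ ⟩
  c ++ (d ++ (concat M ++ concat Y))     ↭⟨ PermP.++⁺ˡ c (PermP.shifts d (concat M)) ⟩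
  c ++ (concat M ++ (d ++ concat Y))     ≡⟨ sym (LP.++-assoc c (concat M) _) ⟩
  (c ++ concat M) ++ (d ++ concat Y)     ∎
  where open Perm.PermutationReasoning

rows-stack : ∀ {a} (M Y : Tab) → length M ≡ length Y → All (λ c → length c ≡ a) M →
  Linked (RowWise _<_) M → Linked (RowWise _<_) Y → Linked (RowWise _<_) (zipWith _++_ M Y)
rows-stack [] [] _ _ _ _ = []
rows-stack (_ ∷ []) (_ ∷ []) _ _ _ _ = [-]
rows-stack (c ∷ c' ∷ M) (d ∷ d' ∷ Y) len (|c| ∷ |c'|∷M) (c<c' ∷ M<) (d<d' ∷ Y<) =
  rowWise-++ c<c' (trans |c| (sym (All.head |c'|∷M))) d<d'
  ∷ rows-stack (c' ∷ M) (d' ∷ Y) (ℕP.suc-injective len) |c'|∷M M< Y<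

columns-stack : ∀ {B} (M Y : Tab) → length M ≡ length Y → All (Linked _<_) M → All (Linked _<_) Y →
  All (All (_≤ B)) M → All (All (B <_)) Y → All (Linked _<_) (zipWith _++_ M Y)
columns-stack [] [] _ _ _ _ _ = []
columns-stack (c ∷ M) (d ∷ Y) len (c↑ ∷ M↑) (d↑ ∷ Y↑) (c≤B ∷ M≤B) (B<d ∷ B<Y) =
  linked-++-separated c↑ d↑ c≤B B<d ∷ columns-stack M Y (ℕP.suc-injective len) M↑ Y↑ M≤B B<Y

stack-standard : ∀ (B a : ℕ) (M X : Tab) → length M ≡ length X → All (λ c → length c ≡ a) M →
  Standard M → All (All (_≤ B)) M → Prestandard X → Standard (stackOn M (addAll B X))
stack-standard B a M X len |M| (M↑ , M-rows , M-distinct) M≤B pre =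
  columns-stack M X' len' M↑ X'↑ M≤B B<X' , stacked-rows , stacked-distinct
  where
  open Prestandard pre
  X' : Tab
  X' = addAll B X
  len' : length M ≡ length X'
  len' = trans len (sym (LP.length-map (map (_+ B)) X))
  X'↑ : All (Linked _<_) X'
  X'↑ = AllP.map⁺ (All.map (λ c↑ → LinkedP.map⁺ (Linked.map (ℕP.+-monoˡ-< B) c↑)) columns)
  B<X' : All (All (B <_)) X'
  B<X' = AllP.map⁺ (All.map (λ c≥1 → AllP.map⁺ (All.map (ℕP.+-monoˡ-≤ B) c≥1)) positive)
  stacked-rows : Linked (AdjRows _<_) (stackOn M X')
  stacked-rows = Linked.map (λ {c} {d} → rowWise⇒adj c d)
    (rows-stack M X' len' |M| (Linked.map (λ {c} {d} → adj⇒rowWise c d) M-rows)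
      (LinkedP.map⁺ (Linked.map (rowWise-map (_+ B) (ℕP.+-monoˡ-< B)) (rows-strict X rows distinct))))
  distinct-parts : Unique (concat M ++ concat X')
  distinct-parts = UniqueP.++⁺ M-distinct
    (subst Unique (sym (LP.concat-map X)) (UniqueP.map⁺ (λ {x} {y} → ℕP.+-cancelʳ-≡ B x y) distinct))
    (λ { (z∈M , z∈X') → ℕP.<⇒≱ (All.lookup (AllP.concat⁺ B<X') z∈X') (All.lookup (AllP.concat⁺ M≤B) z∈M) })
  stacked-distinct : Unique (concat (stackOn M X'))
  stacked-distinct = unique-↭ (Perm.↭-sym (concat-stack-↭ M X' len')) distinct-parts

shape-stack : ∀ a B (M X : Tab) → length M ≡ length X → All (λ c → length c ≡ a) M →
  shape (stackOn M (addAll B X)) ≡ map (λ c → a + length c) X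
shape-stack a B [] [] _ _ = refl
shape-stack a B (c ∷ M) (d ∷ X) len (|c| ∷ |M|) =
  cong₂ _∷_ (trans (LP.length-++ c) (cong₂ _+_ |c| (LP.length-map (_+ B) d))) (shape-stack a B M X (ℕP.suc-injective len) |M|)

-- Column operations for fixed parameters m = n-k and N = 2n+k(w-2).
-- A column of R splits into its small part (entries ≤ m) on top and its
-- large part (entries > m) at the bottom.
module Columns (m N : ℕ) where

  small : List ℕ → List ℕ
  small = filter (_≤? m)

  large : List ℕ → List ℕ
  large = filter (m <?_)

  mirror : ℕ → ℕ
  mirror x = suc N ∸ x

  rotated : List ℕ → List ℕ
  rotated c = reverse (map mirror (large c))

  complement : List ℕ → List ℕ
  complement S = filter (λ x → ¬? (x ∈? S)) (rng 1 m)

  Entry : ℕ → Set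
  Entry x = 1 ≤ x × (m < x → x ≤ N)

  Column : List ℕ → Set
  Column c = Linked _<_ c × All Entry c

  InRange : ℕ → Set
  InRange x = 1 ≤ x × x ≤ m

  small-sorted : ∀ {c} → Column c → Linked _<_ (small c)
  small-sorted (c↑ , _) = LinkedP.filter⁺ (_≤? m) ℕP.<-trans c↑

  small-inRange : ∀ {c} → Column c → All InRange (small c)
  small-inRange {c} (_ , entries) =
    All.zipWith (λ { ((1≤x , _) , x≤m) → 1≤x , x≤m }) (AllP.filter⁺ (_≤? m) entries , AllP.all-filter (_≤? m) c)

  large-bounded : ∀ {c} → Column c → All (_≤ N) (large c)
  large-bounded {c} (_ , entries) =
    All.zipWith (λ { ((_ , bound) , m<x) → bound m<x }) (AllP.filter⁺ (m <?_) entries , AllP.all-filter (m <?_) c)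

  length-small+large : ∀ c → length (small c) + length (large c) ≡ length c
  length-small+large [] = refl
  length-small+large (x ∷ c) with x ≤? m
  ... | yes x≤m rewrite LP.filter-accept (_≤? m) {x} {c} x≤m | LP.filter-reject (m <?_) {x} {c} (ℕP.≤⇒≯ x≤m) =
    cong suc (length-small+large c)
  ... | no x≰m rewrite LP.filter-reject (_≤? m) {x} {c} x≰m | LP.filter-accept (m <?_) {x} {c} (ℕP.≰⇒> x≰m) =
    trans (ℕP.+-suc _ _) (cong suc (length-small+large c))

  small-none : ∀ c → All (m <_) c → small c ≡ []
  small-none c m<c = LP.filter-none (_≤? m) (All.map ℕP.<⇒≱ m<c)

  large-below : ∀ {x c} → ¬ x ≤ m → Linked _<_ (x ∷ c) → All (m <_) c
  large-below x≰m c↑ = All.map (ℕP.<-trans (ℕP.≰⇒> x≰m)) (linked-head ℕP.<-trans c↑)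

  take-small : ∀ c → Linked _<_ c → take (length c ∸ length (large c)) c ≡ small c
  take-small [] _ = refl
  take-small (x ∷ c) c↑ with x ≤? m
  ... | yes x≤m rewrite LP.filter-accept (_≤? m) {x} {c} x≤m
                      | LP.filter-reject (m <?_) {x} {c} (ℕP.≤⇒≯ x≤m)
                      | ℕP.+-∸-assoc 1 (LP.length-filter (m <?_) c) = cong (x ∷_) (take-small c (Linked.tail c↑))
  ... | no x≰m rewrite LP.filter-reject (_≤? m) {x} {c} x≰m
                     | LP.filter-accept (m <?_) {x} {c} (ℕP.≰⇒> x≰m)
                     | LP.filter-all (m <?_) (large-below x≰m c↑)
                     | small-none c (large-below x≰m c↑)
                     | ℕP.n∸n≡0 (length c) = refl

  rowWise-small : ∀ {b a} → RowWise _≤_ b a → Linked _<_ a → RowWise _≤_ (small b) (small a)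
  rowWise-small [] _ = []
  rowWise-small {y ∷ b} {x ∷ a} (y≤x ∷ rs) a↑ with x ≤? m
  ... | yes x≤m rewrite LP.filter-accept (_≤? m) {y} {b} (ℕP.≤-trans y≤x x≤m) | LP.filter-accept (_≤? m) {x} {a} x≤m = y≤x ∷ rowWise-small rs (Linked.tail a↑)
  ... | no x≰m rewrite LP.filter-reject (_≤? m) {x} {a} x≰m | small-none a (large-below x≰m a↑) = []

  -- Large parts of adjacent columns of equal length, read bottom-up
  -- (ys from the right column, xs from the left one), are rowwise comparable.
  rowWise-large : ∀ {ys xs} → Pointwise _≤_ ys xs → Linked _>_ ys → RowWise (flip _≤_) (large xs) (large ys)
  rowWise-large [] _ = []
  rowWise-large {y ∷ ys} {x ∷ xs} (y≤x ∷ rs) ys↓ with m <? y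
  ... | yes m<y rewrite LP.filter-accept (m <?_) {x} {xs} (ℕP.<-≤-trans m<y y≤x) | LP.filter-accept (m <?_) {y} {ys} m<y = y≤x ∷ rowWise-large rs (Linked.tail ys↓)
  ... | no m≮y rewrite LP.filter-reject (m <?_) {y} {ys} m≮y | LP.filter-none (m <?_) {ys} (All.map (λ y'<y m<y' → m≮y (ℕP.<-trans m<y' y'<y)) (linked-head (flip ℕP.<-trans) ys↓)) = []

  complement-sorted : ∀ S → Linked _<_ (complement S)
  complement-sorted S = LinkedP.filter⁺ (λ x → ¬? (x ∈? S)) ℕP.<-trans (rng-sorted 1 m)

  complement-inRange : ∀ S → All InRange (complement S)
  complement-inRange S = AllP.filter⁺ (λ x → ¬? (x ∈? S)) (rng-bounds 1 m)

  filter-∈-rng : ∀ S → Linked _<_ S → All InRange S → filter (_∈? S) (rng 1 m) ≡ S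
  filter-∈-rng S S↑ S∈[m] = sorted-ext (LinkedP.filter⁺ (_∈? S) ℕP.<-trans (rng-sorted 1 m)) S↑
    (λ z∈ → proj₂ (∈P.∈-filter⁻ (_∈? S) {xs = rng 1 m} z∈))
    (λ z∈ → ∈P.∈-filter⁺ (_∈? S) (rng-∈ (proj₁ (All.lookup S∈[m] z∈)) (proj₂ (All.lookup S∈[m] z∈))) z∈)

  length-complement : ∀ S → Linked _<_ S → All InRange S → length S + length (complement S) ≡ m
  length-complement S S↑ S∈[m] = subst (λ S' → length S' + length (complement S) ≡ m) (filter-∈-rng S S↑ S∈[m])
    (trans (length-filter-split (_∈? S) (rng 1 m)) (length-rng m))

  atMost-complement : ∀ S → Linked _<_ S → All InRange S → ∀ y → atMost y S + atMost y (complement S) ≡ atMost y (rng 1 m)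
  atMost-complement S S↑ S∈[m] y = subst (λ S' → atMost y S' + atMost y (complement S) ≡ atMost y (rng 1 m))
    (filter-∈-rng S S↑ S∈[m]) (count-filter-split (_∈? S) (_≤? y) (rng 1 m))

  rowWise-complement : ∀ {S S'} → Linked _<_ S → All InRange S → Linked _<_ S' → All InRange S' →
    RowWise _≤_ S S' → RowWise _≤_ (complement S') (complement S)
  rowWise-complement {S} {S'} S↑ S∈[m] S'↑ S'∈[m] S≤S' =
    atMost⇒rowWise (complement-sorted S') (complement-sorted S) λ y →
      fewer-in-complement (atMost-complement S' S'↑ S'∈[m] y) (atMost-complement S S↑ S∈[m] y)
                          (rowWise⇒atMost S≤S' S'↑ y)
    where
    fewer-in-complement : ∀ {a x b y r} → a + x ≡ r → b + y ≡ r → a ≤ b → y ≤ x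
    fewer-in-complement {a} {x} {b} {y} a+x≡r b+y≡r a≤b =
      ℕP.+-cancelˡ-≤ b y x (subst (_≤ b + x) (trans a+x≡r (sym b+y≡r)) (ℕP.+-monoˡ-≤ x a≤b))

  rotated-sorted : ∀ {c} → Column c → Linked _<_ (rotated c)
  rotated-sorted {c} col = linked-reverse (mirror-decreasing (LinkedP.filter⁺ (m <?_) ℕP.<-trans (proj₁ col)) (large-bounded col))
    where
    mirror-decreasing : ∀ {xs} → Linked _<_ xs → All (_≤ N) xs → Linked _>_ (map mirror xs)
    mirror-decreasing [] _ = []
    mirror-decreasing [-] _ = [-]
    mirror-decreasing (x<y ∷ xs↑) (_ ∷ ys≤N@(y≤N ∷ _)) =
      ℕP.∸-monoʳ-< x<y (ℕP.m≤n⇒m≤1+n y≤N) ∷ mirror-decreasing xs↑ ys≤N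

  rotated-positive : ∀ {c} → Column c → All (1 ≤_) (rotated c)
  rotated-positive col = PermP.All-resp-↭ (Perm.↭-sym (PermP.↭-reverse _))
    (AllP.map⁺ (All.map (λ x≤N → ℕP.m<n⇒0<n∸m (s≤s x≤N)) (large-bounded col)))

  -- Rotation turns bottom-aligned large parts into top-aligned ones, so it
  -- preserves rowwise domination of columns of equal length (in reverse order).
  rowWise-rotated : ∀ {a b} → Linked _<_ b → length b ≡ length a → RowWise _≤_ b a → RowWise _≤_ (rotated a) (rotated b)
  rowWise-rotated {a} {b} b↑ len b≤a = subst₂ (RowWise _≤_) (sym (bottom-up a)) (sym (bottom-up b))
    (rowWise-map mirror (ℕP.∸-monoʳ-≤ (suc N))
      (rowWise-large (Pointwise.reverse⁺ (rowWise⇒pointwise b≤a len)) (linked-reverse b↑)))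
    where
    bottom-up : ∀ c → rotated c ≡ map mirror (large (reverse c))
    bottom-up c = trans (sym (LP.reverse-map mirror (large c))) (cong (map mirror) (sym (filter-reverse (m <?_) c)))

  -- Mirroring is injective on [N], so rotation preserves multiplicities.
  mult-rotated : ∀ z {c} → Column c → mult z (rotated c) ≤ mult (mirror z) (large c)
  mult-rotated z {c} col = subst (_≤ mult (mirror z) (large c)) (sym (mult-↭ z (PermP.↭-reverse (map mirror (large c)))))
    (mult-map mirror (large c) λ {y} y∈ mirror-y≡z →
      trans (sym (ℕP.m∸[m∸n]≡n (ℕP.m≤n⇒m≤1+n (All.lookup (large-bounded col) y∈)))) (cong mirror mirror-y≡z))

  mult-column+complement : ∀ z {c} → Column c → mult z (complement (small c)) + mult z c ≤ 1
  mult-column+complement z {c} col with z ∈? c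
  ... | yes z∈c = subst (λ k → k + mult z c ≤ 1) (sym (mult-∉ _ z∉complement)) (mult-sorted z (proj₁ col))
    where
    z∉complement : z ∉ complement (small c)
    z∉complement z∈ with ∈P.∈-filter⁻ (λ x → ¬? (x ∈? small c)) {xs = rng 1 m} z∈
    ... | z∈[m] , z∉small = z∉small (∈P.∈-filter⁺ (_≤? m) z∈c (proj₂ (All.lookup (rng-bounds 1 m) z∈[m])))
  ... | no z∉c = subst (λ k → mult z (complement (small c)) + k ≤ 1) (sym (mult-∉ c z∉c))
    (subst (_≤ 1) (sym (ℕP.+-identityʳ _)) (mult-sorted z (complement-sorted (small c))))

  complements-inRange : ∀ T → All InRange (concat (map (complement ∘ small) T))
  complements-inRange T = AllP.concat⁺ (AllP.map⁺ {xs = T} (All.tabulate (λ {c} _ → complement-inRange (small c))))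

  mult-complements : ∀ z T → All Column T → (∀ x → InRange x → length T ∸ 1 ≤ mult x (concat T)) →
    mult z (concat (map (complement ∘ small) T)) ≤ 1
  mult-complements z T cols often with 1 ≤? z | z ≤? m
  ... | yes 1≤z | yes z≤m = at-most-one (in-complement-or-column T cols) (often z (1≤z , z≤m))
    where
    in-complement-or-column : ∀ T → All Column T → mult z (concat (map (complement ∘ small) T)) + mult z (concat T) ≤ length T
    in-complement-or-column [] _ = z≤n
    in-complement-or-column (c ∷ T) (col ∷ cols) = begin
      mult z (complement (small c) ++ concat (map (complement ∘ small) T)) + mult z (c ++ concat T)
        ≡⟨ cong₂ _+_ (mult-++ z (complement (small c)) _) (mult-++ z c _) ⟩
      (mult z (complement (small c)) + mult z (concat (map (complement ∘ small) T))) + (mult z c + mult z (concat T))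
        ≡⟨ interchange (mult z (complement (small c))) _ (mult z c) _ ⟩
      (mult z (complement (small c)) + mult z c) + (mult z (concat (map (complement ∘ small) T)) + mult z (concat T))
        ≤⟨ ℕP.+-mono-≤ (mult-column+complement z col) (in-complement-or-column T cols) ⟩
      suc (length T) ∎
      where open ℕP.≤-Reasoning
    at-most-one : ∀ {X Y L} → X + Y ≤ L → L ∸ 1 ≤ Y → X ≤ 1
    at-most-one {X} {Y} {zero} X+Y≤0 _ = ℕP.≤-trans (ℕP.m+n≤o⇒m≤o X X+Y≤0) z≤n
    at-most-one {X} {Y} {suc L} X+Y≤L L≤Y = ℕP.+-cancelʳ-≤ Y X 1 (ℕP.≤-trans X+Y≤L (s≤s L≤Y))
  ... | no 1≰z | _ = ℕP.≤-trans (ℕP.≤-reflexive (mult-All _ (complements-inRange T) (1≰z ∘ proj₁))) z≤n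
  ... | yes _ | no z≰m = ℕP.≤-trans (ℕP.≤-reflexive (mult-All _ (complements-inRange T) (z≰m ∘ proj₂))) z≤n


  mult-rotations : ∀ z T → All Column T → (∀ x → m < x → mult x (concat T) ≤ 1) → mult z (concat (map rotated T)) ≤ 1
  mult-rotations z T cols rare = ℕP.≤-trans (mult-concat rotated large z (mirror z) T (All.map (mult-rotated z) cols)) bound
    where
    bound : mult (mirror z) (concat (map large T)) ≤ 1
    bound with m <? mirror z
    ... | yes large-z = ℕP.≤-trans
          (subst (mult (mirror z) (concat (map large T)) ≤_) (cong (mult (mirror z) ∘ concat) (LP.map-id T))
            (mult-concat large id (mirror z) (mirror z) T (All.tabulate (λ {c} _ → mult-filter (m <?_) (mirror z) c))))
          (rare (mirror z) large-z)
    ... | no small-z = ℕP.≤-trans (ℕP.≤-reflexive (mult-All _ larges small-z)) z≤n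
      where
      larges : All (m <_) (concat (map large T))
      larges = AllP.concat⁺ (AllP.map⁺ {xs = T} (All.tabulate (λ {c} _ → AllP.all-filter (m <?_) c)))

  -- T lists the columns of R from right to left, so each column is
  -- rowwise dominated by the next one.
  P''-prestandard : ∀ T → All Column T → Linked (flip (RowWise _≤_)) T →
    (∀ x → InRange x → length T ∸ 1 ≤ mult x (concat T)) → Prestandard (map (complement ∘ small) T)
  P''-prestandard T cols rows often = record
    { columns = AllP.map⁺ (All.tabulate (λ {c} _ → complement-sorted (small c)))
    ; rows = linked-map (complement ∘ small)
        (λ {c} {d} col-c col-d d≤c → rowWise-complement (small-sorted col-d) (small-inRange col-d)
           (small-sorted col-c) (small-inRange col-c) (rowWise-small d≤c (proj₁ col-c))) cols rows
    ; distinct = mult≤1⇒unique _ (λ z → mult-complements z T cols often)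
    ; positive = AllP.map⁺ (All.tabulate (λ {c} _ → All.map proj₁ (complement-inRange (small c))))
    }

  Q'-prestandard : ∀ {n} T → All Column T → All (λ c → length c ≡ n) T → Linked (flip (RowWise _≤_)) T →
    (∀ x → m < x → mult x (concat T) ≤ 1) → Prestandard (map rotated T)
  Q'-prestandard T cols lengths rows rare = record
    { columns = AllP.map⁺ (All.map rotated-sorted cols)
    ; rows = linked-map rotated
        (λ { (_ , |c|) (col-d , |d|) d≤c → rowWise-rotated (proj₁ col-d) (trans |d| (sym |c|)) d≤c })
        (All.zip (cols , lengths)) rows
    ; distinct = mult≤1⇒unique _ (λ z → mult-rotations z T cols rare)
    ; positive = AllP.map⁺ (All.map rotated-positive cols)
    }

  length-complement-small : ∀ {c} → Column c → length (small c) + length (complement (small c)) ≡ m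
  length-complement-small {c} col = length-complement (small c) (small-sorted col) (small-inRange col)

  length-rotated : ∀ c → length (rotated c) ≡ length (large c)
  length-rotated c = trans (LP.length-reverse (map mirror (large c))) (LP.length-map mirror (large c))

  length-small+rotated : ∀ c → length (small c) + length (rotated c) ≡ length c
  length-small+rotated c = trans (cong (_+_ (length (small c))) (length-rotated c)) (length-small+large c)

-- Defs describes P'' and Q' through column indices (colAt).  The following
-- lemmas identify them with column-wise constructions on reverse R.
colAt-map : ∀ (h : List ℕ → List ℕ) L i → i < length L → colAt (map h L) i ≡ h (colAt L i)
colAt-map h (c ∷ L) zero _ = refl
colAt-map h (c ∷ L) (suc i) (s≤s i<L) = colAt-map h L i i<L

colAt-All : ∀ {P : List ℕ → Set} L i → All P L → i < length L → P (colAt L i)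
colAt-All (c ∷ L) zero (p ∷ _) _ = p
colAt-All (c ∷ L) (suc i) (_ ∷ ps) (s≤s i<L) = colAt-All L i ps i<L

colAt-++ˡ : ∀ L L' i → i < length L → colAt (L ++ L') i ≡ colAt L i
colAt-++ˡ (c ∷ L) L' zero _ = refl
colAt-++ˡ (c ∷ L) L' (suc i) (s≤s i<L) = colAt-++ˡ L L' i i<L

colAt-++-length : ∀ L c L' → colAt (L ++ c ∷ L') (length L) ≡ c
colAt-++-length [] c L' = refl
colAt-++-length (_ ∷ L) c L' = colAt-++-length L c L'

∸-suc-< : ∀ {n i} → i < n → n ∸ suc i < n
∸-suc-< {suc n} {i} _ = s≤s (ℕP.m∸n≤m n i)

colAt-reverse : ∀ L i → i < length L → colAt (reverse L) (length L ∸ suc i) ≡ colAt L i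
colAt-reverse (c ∷ L) zero _ rewrite LP.unfold-reverse c L =
  subst (λ j → colAt (reverse L ++ [ c ]) j ≡ c) (LP.length-reverse L) (colAt-++-length (reverse L) c [])
colAt-reverse (c ∷ L) (suc i) (s≤s i<L) rewrite LP.unfold-reverse c L =
  trans (colAt-++ˡ (reverse L) [ c ] (length L ∸ suc i) (subst (length L ∸ suc i <_) (sym (LP.length-reverse L)) (∸-suc-< i<L)))
        (colAt-reverse L i i<L)

colAt-reverse′ : ∀ L i → i < length L → colAt (reverse L) i ≡ colAt L (length L ∸ suc i)
colAt-reverse′ L i i<L = subst (λ j → colAt (reverse L) j ≡ colAt L (length L ∸ suc i)) (reflect i<L)
  (colAt-reverse L (length L ∸ suc i) (∸-suc-< i<L))
  where
  reflect : ∀ {n i} → i < n → n ∸ suc (n ∸ suc i) ≡ i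
  reflect {suc n} (s≤s i≤n) = ℕP.m∸[m∸n]≡n i≤n

applyUpTo-colAt : ∀ (L : Tab) h → (∀ i → i < length L → h i ≡ colAt L i) → applyUpTo h (length L) ≡ L
applyUpTo-colAt [] h _ = refl
applyUpTo-colAt (c ∷ L) h same = cong₂ _∷_ (same 0 (s≤s z≤n)) (applyUpTo-colAt L (h ∘ suc) (λ i i<L → same (suc i) (s≤s i<L)))

zipWith-upTo-colAt : ∀ (h : ℕ → List ℕ → List ℕ) (h' : List ℕ → List ℕ) (L : Tab) f →
  (∀ i → i < length L → h (f i) (colAt L i) ≡ h' (colAt L i)) → zipWith h (applyUpTo f (length L)) L ≡ map h' L
zipWith-upTo-colAt h h' [] f _ = refl
zipWith-upTo-colAt h h' (c ∷ L) f same =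
  cong₂ _∷_ (same 0 (s≤s z≤n)) (zipWith-upTo-colAt h h' L (f ∘ suc) (λ i i<L → same (suc i) (s≤s i<L)))

module ColumnReading (m N : ℕ) where
  open Columns m N

  Q'-columns : ∀ R → rotatePart m N R ≡ map rotated (reverse R)
  Q'-columns R = sym (LP.reverse-map rotated R)

  minus-columns : ∀ R → All (Linked _<_) R → tabMinus R (rotatePart m N R) ≡ map small R
  minus-columns R R↑ = zipWith-upTo-colAt _ small R id λ i i<R → let c = colAt R i in begin
    take (length c ∸ length (colAt (rotatePart m N R) (length R ∸ suc i))) c
      ≡⟨ cong (λ q → take (length c ∸ length q) c) (rotated-column i i<R) ⟩
    take (length c ∸ length (rotated c)) c
      ≡⟨ cong (λ l → take (length c ∸ l) c) (length-rotated c) ⟩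
    take (length c ∸ length (large c)) c
      ≡⟨ take-small c (colAt-All R i R↑ i<R) ⟩
    small c ∎
    where
    rotated-column : ∀ i → i < length R → colAt (rotatePart m N R) (length R ∸ suc i) ≡ rotated (colAt R i)
    rotated-column i i<R = trans
      (subst (λ l → colAt (reverse (map rotated R)) (l ∸ suc i) ≡ colAt (map rotated R) i) (LP.length-map rotated R)
        (colAt-reverse (map rotated R) i (subst (i <_) (sym (LP.length-map rotated R)) i<R)))
      (colAt-map rotated R i i<R)
    open ≡-Reasoning

  P''-columns : ∀ R → All (Linked _<_) R →
    tabComplement (length R) m (tabMinus R (rotatePart m N R)) ≡ map (complement ∘ small) (reverse R)
  P''-columns R R↑ rewrite minus-columns R R↑ =
    trans (LP.map-upTo _ (length R)) (subst (λ l → applyUpTo column l ≡ P'') |P''| (applyUpTo-colAt P'' column same))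
    where
    column : ℕ → List ℕ
    column i = complement (colAt (map small R) (length R ∸ suc i))
    P'' : Tab
    P'' = map (complement ∘ small) (reverse R)
    |P''| : length P'' ≡ length R
    |P''| = trans (LP.length-map _ (reverse R)) (LP.length-reverse R)
    same : ∀ i → i < length P'' → column i ≡ colAt P'' i
    same i i<P'' = let i<R = subst (i <_) |P''| i<P'' in
      trans (cong complement (colAt-map small R (length R ∸ suc i) (∸-suc-< i<R)))
       (trans (cong (complement ∘ small) (sym (colAt-reverse′ R i i<R)))
              (sym (colAt-map (complement ∘ small) (reverse R) i (subst (i <_) (sym (LP.length-reverse R)) i<R))))

module Content (m N c : ℕ) where
  open Columns m N

  content : List ℕ
  content = concat (map (replicate c) (rng 1 m)) ++ rng (suc m) N

  repeated-inRange : All InRange (concat (map (replicate c) (rng 1 m)))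
  repeated-inRange = AllP.concat⁺ (AllP.map⁺ (All.map (AllP.replicate⁺ c) (rng-bounds 1 m)))

  content-entries : All Entry content
  content-entries = AllP.++⁺ (All.map (λ { (1≤x , x≤m) → 1≤x , λ m<x → ⊥-elim (ℕP.<⇒≱ m<x x≤m) }) repeated-inRange)
                             (All.map (λ { (m<x , x≤N) → ℕP.≤-trans (s≤s z≤n) m<x , λ _ → x≤N }) (rng-bounds (suc m) N))

  content-rare : ∀ z → m < z → mult z content ≤ 1
  content-rare z m<z = subst (_≤ 1) (sym (mult-++ z (concat (map (replicate c) (rng 1 m))) _))
    (subst (λ k → k + mult z (rng (suc m) N) ≤ 1) (sym (mult-All _ repeated-inRange (ℕP.<⇒≱ m<z ∘ proj₂)))
      (mult-sorted z (rng-sorted (suc m) N)))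

  content-often : ∀ z → InRange z → c ≤ mult z content
  content-often z (1≤z , z≤m) = subst (c ≤_) (sym (mult-++ z (concat (map (replicate c) (rng 1 m))) _))
    (ℕP.≤-trans (repeated (rng 1 m) (rng-∈ 1≤z z≤m)) (ℕP.m≤m+n _ _))
    where
    copies : ∀ k → mult z (replicate k z) ≡ k
    copies zero = refl
    copies (suc k) = trans (mult-hit (replicate k z) refl) (cong suc (copies k))
    repeated : ∀ L → z ∈ L → c ≤ mult z (concat (map (replicate c) L))
    repeated (x ∷ L) (here refl) = subst (c ≤_) (sym (mult-++ z (replicate c z) _))
      (subst (λ k → c ≤ k + mult z (concat (map (replicate c) L))) (sym (copies c)) (ℕP.m≤m+n c _))
    repeated (x ∷ L) (there z∈L) = subst (c ≤_) (sym (mult-++ z (replicate c x) _))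
      (ℕP.≤-trans (repeated L z∈L) (ℕP.m≤n+m _ _))

shift-lengths : ∀ {s p q u v a} → s + p ≡ u → s + q ≡ v → u + a ≡ v → a + p ≡ q
shift-lengths {s} {p} {q} {u} {v} {a} s+p≡u s+q≡v u+a≡v = ℕP.+-cancelˡ-≡ s (a + p) q (begin
  s + (a + p)  ≡⟨ x∙yz≈y∙xz s a p ⟩
  a + (s + p)  ≡⟨ cong (_+_ a) s+p≡u ⟩
  a + u        ≡⟨ ℕP.+-comm a u ⟩
  u + a        ≡⟨ u+a≡v ⟩
  v            ≡⟨ sym s+q≡v ⟩
  s + q        ∎)
  where open ≡-Reasoning

-- The hypotheses of the lemma, for w = length R; T lists the columns of R
-- from right to left, the order in which they give the columns of P'' and Q'.
module Setting (n : ℕ) (k : ℤ) (R : Tab) (|R| : All (λ c → length c ≡ n) R) (R-ss : Semistandard R)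
  (R-content : concat R ↭ contentR n (length R) k) (M : Tab) (|M|≡w : length M ≡ length R)
  (|M| : All (λ c → length c ≡ ∣ k ∣) M) (M-std : Standard M) (M-content : concat M ↭ rng 1 (∣ k ∣ * length R)) where

  w m N a B : ℕ
  w = length R
  m = mOf n k
  N = NOf n w k
  a = ∣ k ∣
  B = a * w
  open Columns m N
  open ColumnReading m N
  open Content m N (w ∸ 1)

  T : Tab
  T = reverse R

  R↑ : All (Linked _<_) R
  R↑ = proj₁ R-ss

  T-content : concat T ↭ content
  T-content = Perm.trans (concat-reverse R) R-content

  T-lengths : All (λ c → length c ≡ n) T
  T-lengths = PermP.All-resp-↭ (Perm.↭-sym (PermP.↭-reverse R)) |R|

  T-columns : All Column T
  T-columns = PermP.All-resp-↭ (Perm.↭-sym (PermP.↭-reverse R))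
    (All.zip (R↑ , AllP.concat⁻ (PermP.All-resp-↭ (Perm.↭-sym R-content) content-entries)))

  T-rows : Linked (flip (RowWise _≤_)) T
  T-rows = linked-reverse (Linked.map (λ {c} {d} → adj⇒rowWise c d) (proj₂ R-ss))

  T-often : ∀ x → InRange x → length T ∸ 1 ≤ mult x (concat T)
  T-often x x∈[m] = subst₂ _≤_ (cong (_∸ 1) (sym (LP.length-reverse R))) (sym (mult-↭ x T-content)) (content-often x x∈[m])

  T-rare : ∀ x → m < x → mult x (concat T) ≤ 1
  T-rare x m<x = subst (_≤ 1) (sym (mult-↭ x T-content)) (content-rare x m<x)

  M-bounded : All (All (_≤ B)) M
  M-bounded = AllP.concat⁻ (PermP.All-resp-↭ (Perm.↭-sym M-content) (All.map proj₂ (rng-bounds 1 B)))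

  |M|≡|T| : ∀ (h : List ℕ → List ℕ) → length M ≡ length (map h T)
  |M|≡|T| h = trans |M|≡w (sym (trans (LP.length-map h T) (LP.length-reverse R)))

  P''-standard : Standard (stackOn M (addAll B (P''Of n w k R)))
  P''-standard = subst (λ X → Standard (stackOn M (addAll B X))) (sym (P''-columns R R↑))
    (stack-standard B a M _ (|M|≡|T| _) |M| M-std M-bounded (P''-prestandard T T-columns T-rows T-often))

  Q'-standard : Standard (stackOn M (addAll B (Q'Of n w k R)))
  Q'-standard = subst (λ X → Standard (stackOn M (addAll B X))) (sym (Q'-columns R))
    (stack-standard B a M _ (|M|≡|T| _) |M| M-std M-bounded (Q'-prestandard T T-columns T-lengths T-rows T-rare))

  column-lengths : All (λ c → length (small c) + length (complement (small c)) ≡ m × length (small c) + length (rotated c) ≡ n) T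
  column-lengths = All.map (λ { {c} (col , |c|) → length-complement-small col , trans (length-small+rotated c) |c| })
    (All.zip (T-columns , T-lengths))

  shape-stacked : ∀ {h h'} X X' → X ≡ map h T → X' ≡ map h' T → All (λ c → a + length (h c) ≡ length (h' c)) T →
    shape (stackOn M (addAll B X)) ≡ shape X'
  shape-stacked {h} {h'} _ _ refl refl same = begin
    shape (stackOn M (addAll B (map h T)))  ≡⟨ shape-stack a B M _ (|M|≡|T| h) |M| ⟩
    map (λ c → a + length c) (map h T)      ≡⟨ sym (LP.map-∘ T) ⟩
    map (λ c → a + length (h c)) T          ≡⟨ LP.map-cong-local same ⟩
    map (length ∘ h') T                     ≡⟨ LP.map-∘ T ⟩
    shape (map h' T)                        ∎
    where open ≡-Reasoning

  shapes-positive : m + a ≡ n → shape (stackOn M (addAll B (P''Of n w k R))) ≡ shape (Q'Of n w k R)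
  shapes-positive m+a≡n = shape-stacked _ _ (P''-columns R R↑) (Q'-columns R)
    (All.map (λ (P''-len , Q'-len) → shift-lengths P''-len Q'-len m+a≡n) column-lengths)

  shapes-nonpositive : n + a ≡ m → shape (stackOn M (addAll B (Q'Of n w k R))) ≡ shape (P''Of n w k R)
  shapes-nonpositive n+a≡m = shape-stacked _ _ (Q'-columns R) (P''-columns R R↑)
    (All.map (λ (P''-len , Q'-len) → shift-lengths Q'-len P''-len n+a≡m) column-lengths)

lemma5p2 : (n w : ℕ) (k : ℤ) → 2 ≤ w → w ≤ n
    → ℤ.- (+ n) ℤ.≤ k ℤ.* + (w ∸ 1) → k ℤ.≤ + n
    → (R : Tab) → length R ≡ w → All (λ c → length c ≡ n) R
    → Semistandard R → concat R ↭ contentR n w k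
    → (M : Tab) → length M ≡ w → All (λ c → length c ≡ ∣ k ∣) M
    → Standard M → concat M ↭ rng 1 (∣ k ∣ * w)
    → Standard (POf n w k R M) × shape (POf n w k R M) ≡ shape (QOf n w k R)
-- For k > 0, P' = P'' and Q = Q', and m = n - k follows from k ≤ n; for
-- k ≤ 0, P' = Q' and Q = P'', and m = n + |k| holds by computation.
lemma5p2 n _ k@(+ suc j) _ _ _ k≤n R refl |R| R-ss R-content M |M|≡w |M| M-std M-content =
  P''-standard , shapes-positive (trans (cong (_+ suc j) m≡n∸a) (ℕP.m∸n+n≡m a≤n))
  where
  open Setting n k R |R| R-ss R-content M |M|≡w |M| M-std M-content
  a≤n : suc j ≤ n
  a≤n = ℤP.drop‿+≤+ k≤n
  m≡n∸a : m ≡ n ∸ suc j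
  m≡n∸a = cong ∣_∣ (ℤP.⊖-≥ a≤n)
lemma5p2 n _ k@(+ zero) _ _ _ _ R refl |R| R-ss R-content M |M|≡w |M| M-std M-content =
  Q'-standard , shapes-nonpositive refl
  where open Setting n k R |R| R-ss R-content M |M|≡w |M| M-std M-content
lemma5p2 n _ k@(-[1+ j ]) _ _ _ _ R refl |R| R-ss R-content M |M|≡w |M| M-std M-content =
  Q'-standard , shapes-nonpositive refl
  where open Setting n k R |R| R-ss R-content M |M|≡w |M| M-std M-content
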